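{- The logic $\mathsf S$ is decidable: there is an algorithm which, given $\varphi\in\mathrm{Fm}_{\mathsf S}$, decides whether $\vdash_{\mathsf S}\varphi$.
   Context: Let $Ag$ be a non-empty finite set of agents and $Var$ a countably infinite set of propositional variables. The formulas $\mathrm{Fm}_{\mathsf S}$ are generated by $\varphi::=p\mid\neg\varphi\mid\varphi\land\varphi\mid I_a\varphi\mid K_a\varphi\mid B_a\varphi$ ($p\in Var$, $a\in Ag$). The logic $\mathsf S$ ($\vdash_{\mathsf S}\varphi$ means $\varphi$ is derivable) has as axioms: all classical propositional tautologies; for each $a\in Ag$ and each $\star\in\{K_a,B_a,I_a\}$, $\star(\varphi\to\psi)\to(\star\varphi\to\star\psi)$; $K_a\varphi\to\varphi$; $K_a\varphi\to K_aK_a\varphi$; $B_a\varphi\to\neg B_a\neg\varphi$; $K_a\varphi\to B_a\varphi$; $B_a\varphi\to K_aB_a\varphi$; $I_a\varphi\to\neg I_a\neg\varphi$; $I_a\varphi\to K_aI_a\varphi$; $I_a\varphi\to I_aK_a\varphi$; $I_a\varphi\to I_aI_a\varphi$; and as rules modus ponens and necessitation for each $K_a,B_a,I_a$. -}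

module Defs where

open import Data.Nat using (ℕ; suc)
open import Data.Fin using (Fin)
open import Data.Bool using (Bool; true; false; not; _∧_)
open import Relation.Binary.PropositionalEquality using (_≡_)

-- Agents: a non-empty finite set Ag, represented as Fin (suc n) (any n : ℕ).
-- Propositional variables: a countably infinite set Var, represented as ℕ.

Ag : ℕ → Set
Ag n = Fin (suc n)

Var : Set
Var = ℕ

data Fm (n : ℕ) : Set where
  var  : Var → Fm n
  ¬'_  : Fm n → Fm n
  _∧'_ : Fm n → Fm n → Fm n
  I    : Ag n → Fm n → Fm n
  K    : Ag n → Fm n → Fm n
  B    : Ag n → Fm n → Fm n

infixr 6 _∧'_
infix 7 ¬'_
infixr 5 _→'_

_→'_ : ∀ {n} → Fm n → Fm n → Fm n
φ →' ψ = ¬' (φ ∧' ¬' ψ)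

-- Classical (Boolean) evaluation where every formula not headed by ¬ or ∧
-- (i.e. variables and modal formulas) is treated as a propositional atom,
-- with truth value given by v.
⟦_⟧ : ∀ {n} → Fm n → (Fm n → Bool) → Bool
⟦ var p ⟧ v = v (var p)
⟦ ¬' φ ⟧ v = not (⟦ φ ⟧ v)
⟦ φ ∧' ψ ⟧ v = ⟦ φ ⟧ v ∧ ⟦ ψ ⟧ v
⟦ I a φ ⟧ v = v (I a φ)
⟦ K a φ ⟧ v = v (K a φ)
⟦ B a φ ⟧ v = v (B a φ)

Taut : ∀ {n} → Fm n → Set
Taut {n} φ = (v : Fm n → Bool) → ⟦ φ ⟧ v ≡ true

data ⊢_ {n : ℕ} : Fm n → Set where
  taut   : ∀ {φ} → Taut φ → ⊢ φ
  K-I    : ∀ a φ ψ → ⊢ (I a (φ →' ψ) →' (I a φ →' I a ψ))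
  K-K    : ∀ a φ ψ → ⊢ (K a (φ →' ψ) →' (K a φ →' K a ψ))
  K-B    : ∀ a φ ψ → ⊢ (B a (φ →' ψ) →' (B a φ →' B a ψ))
  T-K    : ∀ a φ → ⊢ (K a φ →' φ)
  4-K    : ∀ a φ → ⊢ (K a φ →' K a (K a φ))
  D-B    : ∀ a φ → ⊢ (B a φ →' ¬' B a (¬' φ))
  KB     : ∀ a φ → ⊢ (K a φ →' B a φ)
  BKB    : ∀ a φ → ⊢ (B a φ →' K a (B a φ))
  D-I    : ∀ a φ → ⊢ (I a φ →' ¬' I a (¬' φ))
  IKI    : ∀ a φ → ⊢ (I a φ →' K a (I a φ))
  IIK    : ∀ a φ → ⊢ (I a φ →' I a (K a φ))
  4-I    : ∀ a φ → ⊢ (I a φ →' I a (I a φ))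
  mp     : ∀ {φ ψ} → ⊢ (φ →' ψ) → ⊢ φ → ⊢ ψ
  nec-I  : ∀ a {φ} → ⊢ φ → ⊢ I a φ
  nec-K  : ∀ a {φ} → ⊢ φ → ⊢ K a φ
  nec-B  : ∀ a {φ} → ⊢ φ → ⊢ B a φ

{-# OPTIONS --safe #-}
module Submission where

-- Decidability follows from a finite model property obtained by elimination of Hintikka
-- valuations.  Fix the closure Cl of φ and start from all Boolean valuations of Cl, each
-- described by its characteristic conjunction.  Repeatedly discard every valuation that is
-- not Hintikka relative to the remaining ones: propositionally incoherent, K_a ψ true but ψ
-- false, a false □ψ without a remaining successor refuting ψ, or no B_a- or I_a-successor.
-- The axioms make the characteristic formula of each discarded valuation refutable, so the
-- survivors cover all consistent valuations; and the survivors, with the canonical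
-- accessibility relations, form a finite model of S in which truth agrees with the valuation
-- on Cl.  So either a survivor falsifies φ, and soundness refutes ⊢ φ, or every consistent
-- valuation of Cl makes φ true, and a case distinction over them derives φ.

open import Data.Bool using (Bool; true; false; not; _∧_; T; if_then_else_)
open import Data.Bool.Properties as Bool using (T-≡; T-not-≡; T-∧)
open import Data.Empty using (⊥-elim)
open import Data.Fin as Fin using ()
open import Data.Fin.Properties as Fin using ()
open import Data.List using (List; []; _∷_; _++_; foldr; map; concatMap; filter; length; cartesianProductWith)
open import Data.List.Membership.Propositional using (_∈_; find; lose)
open import Data.List.Membership.Propositional.Properties
  using (∈-++⁺ˡ; ∈-++⁺ʳ; ∈-++⁻; ∈-filter⁺; ∈-filter⁻; ∈-concatMap⁺; ∈-concatMap⁻; ∈-cartesianProductWith⁺)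
open import Data.List.Properties using (filter-notAll)
open import Data.List.Relation.Binary.Subset.Propositional using (_⊆_)
open import Data.List.Relation.Unary.All as All using (All; []; _∷_)
import Data.List.Relation.Unary.All.Properties as All
open import Data.List.Relation.Unary.Any using (Any; here; there; any?)
open import Data.Nat as ℕ using (ℕ; suc; s≤s; _<_)
open import Data.Nat.Properties as ℕ using ()
open import Data.Product using (_×_; _,_; ∃-syntax; proj₁; proj₂; uncurry)
open import Data.Sum using (_⊎_; inj₁; inj₂; [_,_])
open import Data.Unit using (⊤; tt)
open import Function using (_∘_; id; Equivalence)
open import Relation.Binary.Definitions using (DecidableEquality)
open import Relation.Binary.PropositionalEquality using (_≡_; refl; sym; trans; cong; cong₂; subst)
open import Relation.Nullary using (¬_; Dec; yes; no; does; map′; _×-dec_; _→-dec_; ¬?; T?)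
open import Relation.Nullary.Decidable using (⌊_⌋; dec-true; decidable-stable; toWitness; fromWitness)
open import Relation.Unary using (Decidable)

open import Defs

open Equivalence using (to; from)

private
  T-not⁺ : ∀ {x} → ¬ T x → T (not x)
  T-not⁺ {false} _ = tt
  T-not⁺ {true} ¬t = ¬t tt

  T-not⁻ : ∀ {x} → T (not x) → ¬ T x
  T-not⁻ {false} _ ()

  T-⇒⁺ : ∀ {x y} → (T x → T y) → T (not (x ∧ not y))
  T-⇒⁺ {false} _ = tt
  T-⇒⁺ {true} {true} _ = tt
  T-⇒⁺ {true} {false} f = f tt

  T-⇒⁻ : ∀ {x y} → T (not (x ∧ not y)) → T x → T y
  T-⇒⁻ {true} {true} _ _ = tt

  T-injective : ∀ {x y} → (T x → T y) → (T y → T x) → x ≡ y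
  T-injective {false} {false} _ _ = refl
  T-injective {false} {true} _ g = ⊥-elim (g tt)
  T-injective {true} {false} f _ = ⊥-elim (f tt)
  T-injective {true} {true} _ _ = refl

module _ {n : ℕ} where

  Valuation : Set
  Valuation = Fm n → Bool

  -- A record rather than T (⟦ φ ⟧ v), so that φ can be inferred from a proof of v ⊨ φ.
  infix 4 _⊨_
  record _⊨_ (v : Valuation) (φ : Fm n) : Set where
    constructor ⊨⁺
    field ⊨⁻ : T (⟦ φ ⟧ v)
  open _⊨_ public

  variable
    v : Valuation
    φ ψ χ τ γ : Fm n
    Γ : List (Fm n)
    a : Ag n
    b : Bool
    d e f w : Valuation
    S : List Valuation

  ⊨¬⁺ : ¬ v ⊨ φ → v ⊨ ¬' φ
  ⊨¬⁺ h = ⊨⁺ (T-not⁺ (h ∘ ⊨⁺))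

  ⊨¬⁻ : v ⊨ ¬' φ → ¬ v ⊨ φ
  ⊨¬⁻ (⊨⁺ t) (⊨⁺ s) = T-not⁻ t s

  ⊨∧⁺ : v ⊨ φ → v ⊨ ψ → v ⊨ φ ∧' ψ
  ⊨∧⁺ (⊨⁺ s) (⊨⁺ t) = ⊨⁺ (from T-∧ (s , t))

  ⊨∧⁻ : v ⊨ φ ∧' ψ → v ⊨ φ × v ⊨ ψ
  ⊨∧⁻ (⊨⁺ t) = let s , u = to T-∧ t in ⊨⁺ s , ⊨⁺ u

  ⊨→⁺ : (v ⊨ φ → v ⊨ ψ) → v ⊨ φ →' ψ
  ⊨→⁺ h = ⊨⁺ (T-⇒⁺ (⊨⁻ ∘ h ∘ ⊨⁺))

  ⊨→⁻ : v ⊨ φ →' ψ → v ⊨ φ → v ⊨ ψ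
  ⊨→⁻ (⊨⁺ t) (⊨⁺ s) = ⊨⁺ (T-⇒⁻ t s)

  ⊤' : Fm n
  ⊤' = ¬' (var 0 ∧' ¬' var 0)

  ⋀ : List (Fm n) → Fm n
  ⋀ = foldr _∧'_ ⊤'

  ⊨⊤ : v ⊨ ⊤'
  ⊨⊤ = ⊨¬⁺ λ p∧¬p → let p , ¬p = ⊨∧⁻ p∧¬p in ⊨¬⁻ ¬p p

  ⊨⋀⁺ : All (v ⊨_) Γ → v ⊨ ⋀ Γ
  ⊨⋀⁺ [] = ⊨⊤
  ⊨⋀⁺ (h ∷ hs) = ⊨∧⁺ h (⊨⋀⁺ hs)

  ⊨⋀⁻ : v ⊨ ⋀ Γ → All (v ⊨_) Γ
  ⊨⋀⁻ {Γ = []} _ = []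
  ⊨⋀⁻ {Γ = _ ∷ _} h = let h₁ , h₂ = ⊨∧⁻ h in h₁ ∷ ⊨⋀⁻ h₂

  taut-consequence : All ⊢_ Γ → (∀ v → All (v ⊨_) Γ → v ⊨ φ) → ⊢ φ
  taut-consequence [] h = taut λ v → to T-≡ (⊨⁻ (h v []))
  taut-consequence (p ∷ ps) h = mp (taut-consequence ps λ v hs → ⊨→⁺ λ a → h v (a ∷ hs)) p

  ⊢-id : ⊢ (φ →' φ)
  ⊢-id = taut-consequence [] λ _ _ → ⊨→⁺ id

  ⊢-trans : ⊢ (φ →' ψ) → ⊢ (ψ →' χ) → ⊢ (φ →' χ)
  ⊢-trans p q = taut-consequence (p ∷ q ∷ []) λ { _ (φ⇒ψ ∷ ψ⇒χ ∷ []) → ⊨→⁺ (⊨→⁻ ψ⇒χ ∘ ⊨→⁻ φ⇒ψ) }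

  ⊢¬-intro : ⊢ (φ →' ψ) → ⊢ (φ →' ¬' ψ) → ⊢ (¬' φ)
  ⊢¬-intro p q = taut-consequence (p ∷ q ∷ []) λ { _ (φ⇒ψ ∷ φ⇒¬ψ ∷ []) → ⊨¬⁺ λ φ → ⊨¬⁻ (⊨→⁻ φ⇒¬ψ φ) (⊨→⁻ φ⇒ψ φ) }

  ⊢-explode : ⊢ (¬' φ) → ⊢ (φ →' ψ)
  ⊢-explode p = taut-consequence (p ∷ []) λ { _ (¬φ ∷ []) → ⊨→⁺ λ φ → ⊥-elim (⊨¬⁻ ¬φ φ) }

  record IsNormal (□ : Fm n → Fm n) : Set where
    field
      distrib : ∀ φ ψ → ⊢ (□ (φ →' ψ) →' (□ φ →' □ ψ))
      necessitation : ⊢ φ → ⊢ □ φ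

  module Normal {□ : Fm n → Fm n} (normal : IsNormal □) where
    open IsNormal normal

    □-mono : ⊢ (φ →' ψ) → ⊢ (□ φ →' □ ψ)
    □-mono p = mp (distrib _ _) (necessitation p)

    □-⋀ : ∀ Γ → (∀ {τ} → τ ∈ Γ → ⊢ (γ →' □ τ)) → ⊢ (γ →' □ (⋀ Γ))
    □-⋀ [] _ = taut-consequence (necessitation (taut-consequence [] λ _ _ → ⊨⊤) ∷ [])
      λ { _ (□⊤ ∷ []) → ⊨→⁺ λ _ → □⊤ }
    □-⋀ (τ ∷ Γ) h = taut-consequence (h (here refl) ∷ □-⋀ Γ (h ∘ there) ∷ □-mono pair ∷ distrib _ _ ∷ [])
      λ { _ (□τ ∷ □⋀Γ ∷ □pair ∷ dist ∷ []) → ⊨→⁺ λ γ → ⊨→⁻ (⊨→⁻ dist (⊨→⁻ □pair (⊨→⁻ □τ γ))) (⊨→⁻ □⋀Γ γ) }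
      where
      pair : ⊢ (τ →' (⋀ Γ →' τ ∧' ⋀ Γ))
      pair = taut-consequence [] λ _ _ → ⊨→⁺ λ a → ⊨→⁺ (⊨∧⁺ a)

  infix 4 _≟_
  _≟_ : DecidableEquality (Fm n)
  var p ≟ var q = map′ (cong var) (λ { refl → refl }) (p ℕ.≟ q)
  ¬' φ ≟ ¬' ψ = map′ (cong ¬'_) (λ { refl → refl }) (φ ≟ ψ)
  φ ∧' φ′ ≟ ψ ∧' ψ′ = map′ (λ { (refl , refl) → refl }) (λ { refl → refl , refl }) (φ ≟ ψ ×-dec φ′ ≟ ψ′)
  I a φ ≟ I b ψ = map′ (λ { (refl , refl) → refl }) (λ { refl → refl , refl }) (a Fin.≟ b ×-dec φ ≟ ψ)
  K a φ ≟ K b ψ = map′ (λ { (refl , refl) → refl }) (λ { refl → refl , refl }) (a Fin.≟ b ×-dec φ ≟ ψ)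
  B a φ ≟ B b ψ = map′ (λ { (refl , refl) → refl }) (λ { refl → refl , refl }) (a Fin.≟ b ×-dec φ ≟ ψ)
  var _ ≟ ¬' _ = no λ ()
  var _ ≟ _ ∧' _ = no λ ()
  var _ ≟ I _ _ = no λ ()
  var _ ≟ K _ _ = no λ ()
  var _ ≟ B _ _ = no λ ()
  ¬' _ ≟ var _ = no λ ()
  ¬' _ ≟ _ ∧' _ = no λ ()
  ¬' _ ≟ I _ _ = no λ ()
  ¬' _ ≟ K _ _ = no λ ()
  ¬' _ ≟ B _ _ = no λ ()
  _ ∧' _ ≟ var _ = no λ ()
  _ ∧' _ ≟ ¬' _ = no λ ()
  _ ∧' _ ≟ I _ _ = no λ ()
  _ ∧' _ ≟ K _ _ = no λ ()
  _ ∧' _ ≟ B _ _ = no λ ()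
  I _ _ ≟ var _ = no λ ()
  I _ _ ≟ ¬' _ = no λ ()
  I _ _ ≟ _ ∧' _ = no λ ()
  I _ _ ≟ K _ _ = no λ ()
  I _ _ ≟ B _ _ = no λ ()
  K _ _ ≟ var _ = no λ ()
  K _ _ ≟ ¬' _ = no λ ()
  K _ _ ≟ _ ∧' _ = no λ ()
  K _ _ ≟ I _ _ = no λ ()
  K _ _ ≟ B _ _ = no λ ()
  B _ _ ≟ var _ = no λ ()
  B _ _ ≟ ¬' _ = no λ ()
  B _ _ ≟ _ ∧' _ = no λ ()
  B _ _ ≟ I _ _ = no λ ()
  B _ _ ≟ K _ _ = no λ ()

  -- I a ψ brings K a ψ along, as the axiom I_a φ → I_a K_a φ requires.
  closure : Fm n → List (Fm n)
  closure (var p) = var p ∷ []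
  closure (¬' ψ) = ¬' ψ ∷ closure ψ
  closure (ψ ∧' χ) = ψ ∧' χ ∷ closure ψ ++ closure χ
  closure (K a ψ) = K a ψ ∷ closure ψ
  closure (B a ψ) = B a ψ ∷ closure ψ
  closure (I a ψ) = I a ψ ∷ K a ψ ∷ closure ψ

  record Closed (Cl : List (Fm n)) : Set where
    field
      ¬-closed : ¬' ψ ∈ Cl → ψ ∈ Cl
      ∧-closedˡ : ψ ∧' χ ∈ Cl → ψ ∈ Cl
      ∧-closedʳ : ψ ∧' χ ∈ Cl → χ ∈ Cl
      K-closed : K a ψ ∈ Cl → ψ ∈ Cl
      B-closed : B a ψ ∈ Cl → ψ ∈ Cl
      I-closed : I a ψ ∈ Cl → ψ ∈ Cl
      I⇒K-closed : I a ψ ∈ Cl → K a ψ ∈ Cl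

  ∈-closure : ∀ φ → φ ∈ closure φ
  ∈-closure (var _) = here refl
  ∈-closure (¬' _) = here refl
  ∈-closure (_ ∧' _) = here refl
  ∈-closure (I _ _) = here refl
  ∈-closure (K _ _) = here refl
  ∈-closure (B _ _) = here refl

  closure-⊆ : ∀ φ → ψ ∈ closure φ → closure ψ ⊆ closure φ
  closure-⊆ (var _) (here refl) = id
  closure-⊆ (¬' _) (here refl) = id
  closure-⊆ (¬' φ) (there ψ∈) = there ∘ closure-⊆ φ ψ∈
  closure-⊆ (_ ∧' _) (here refl) = id
  closure-⊆ (φ ∧' φ′) (there ψ∈) with ∈-++⁻ (closure φ) ψ∈
  ... | inj₁ ψ∈φ = there ∘ ∈-++⁺ˡ ∘ closure-⊆ φ ψ∈φ
  ... | inj₂ ψ∈φ′ = there ∘ ∈-++⁺ʳ (closure φ) ∘ closure-⊆ φ′ ψ∈φ′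
  closure-⊆ (K _ _) (here refl) = id
  closure-⊆ (K _ φ) (there ψ∈) = there ∘ closure-⊆ φ ψ∈
  closure-⊆ (B _ _) (here refl) = id
  closure-⊆ (B _ φ) (there ψ∈) = there ∘ closure-⊆ φ ψ∈
  closure-⊆ (I _ _) (here refl) = id
  closure-⊆ (I _ _) (there (here refl)) (here refl) = there (here refl)
  closure-⊆ (I _ _) (there (here refl)) (there χ∈) = there (there χ∈)
  closure-⊆ (I _ φ) (there (there ψ∈)) = there ∘ there ∘ closure-⊆ φ ψ∈

  closure-closed : ∀ φ → Closed (closure φ)
  closure-closed φ = record
    { ¬-closed = λ {ψ} ψ∈ → closure-⊆ φ ψ∈ (there (∈-closure ψ))
    ; ∧-closedˡ = λ {ψ} ψ∈ → closure-⊆ φ ψ∈ (there (∈-++⁺ˡ (∈-closure ψ)))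
    ; ∧-closedʳ = λ {ψ} {χ} ψ∈ → closure-⊆ φ ψ∈ (there (∈-++⁺ʳ (closure ψ) (∈-closure χ)))
    ; K-closed = λ {_} {ψ} ψ∈ → closure-⊆ φ ψ∈ (there (∈-closure ψ))
    ; B-closed = λ {_} {ψ} ψ∈ → closure-⊆ φ ψ∈ (there (∈-closure ψ))
    ; I-closed = λ {_} {ψ} ψ∈ → closure-⊆ φ ψ∈ (there (there (∈-closure ψ)))
    ; I⇒K-closed = λ ψ∈ → closure-⊆ φ ψ∈ (there (here refl))
    }

  -- χ ↝ τ: wherever χ holds, τ must hold at every □-successor in the canonical model
  -- (justified by ↝-□).
  record Modality : Set₁ where
    field
      □ : Fm n → Fm n
      isNormal : IsNormal □
      _↝_ : Fm n → Fm n → Set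
      targets : Fm n → List (Fm n)
      ∈-targets⁺ : χ ↝ τ → τ ∈ targets χ
      ∈-targets⁻ : τ ∈ targets χ → χ ↝ τ
      ↝-□ : χ ↝ τ → ⊢ (χ →' □ τ)
      ↝-closed : Closed Γ → χ ∈ Γ → χ ↝ τ → τ ∈ Γ

  data Introspective (a : Ag n) : Fm n → Set where
    known : Introspective a (K a ψ)
    believed : Introspective a (B a ψ)
    intended : Introspective a (I a ψ)

  introspective? : ∀ a → Decidable (Introspective a)
  introspective? a (K b _) = map′ (λ { refl → known }) (λ { known → refl }) (b Fin.≟ a)
  introspective? a (B b _) = map′ (λ { refl → believed }) (λ { believed → refl }) (b Fin.≟ a)
  introspective? a (I b _) = map′ (λ { refl → intended }) (λ { intended → refl }) (b Fin.≟ a)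
  introspective? a (var _) = no λ ()
  introspective? a (¬' _) = no λ ()
  introspective? a (_ ∧' _) = no λ ()

  introspection : Introspective a χ → ⊢ (χ →' K a χ)
  introspection known = 4-K _ _
  introspection believed = BKB _ _
  introspection intended = IKI _ _

  data KStep (a : Ag n) : Fm n → Fm n → Set where
    introspect : Introspective a χ → KStep a χ χ

  data BStep (a : Ag n) : Fm n → Fm n → Set where
    known : KStep a χ τ → BStep a χ τ
    believe : BStep a (B a ψ) ψ

  data IStep (a : Ag n) : Fm n → Fm n → Set where
    introspect : IStep a (I a ψ) (I a ψ)
    know : IStep a (I a ψ) (K a ψ)
    intend : IStep a (I a ψ) ψ

  knowledgeTargets : Ag n → Fm n → List (Fm n)
  knowledgeTargets a χ = filter (introspective? a) (χ ∷ [])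

  ∈-knowledgeTargets⁺ : KStep a χ τ → τ ∈ knowledgeTargets a χ
  ∈-knowledgeTargets⁺ (introspect i) = ∈-filter⁺ (introspective? _) (here refl) i

  ∈-knowledgeTargets⁻ : τ ∈ knowledgeTargets a χ → KStep a χ τ
  ∈-knowledgeTargets⁻ {a = a} {χ = χ} m with ∈-filter⁻ (introspective? a) {xs = χ ∷ []} m
  ... | here refl , i = introspect i

  believedBy : Ag n → Fm n → List (Fm n)
  believedBy a (B b ψ) = if does (b Fin.≟ a) then ψ ∷ [] else []
  believedBy a _ = []

  ∈-believedBy⁺ : ψ ∈ believedBy a (B a ψ)
  ∈-believedBy⁺ {a = a} rewrite dec-true (a Fin.≟ a) refl = here refl

  ∈-believedBy⁻ : τ ∈ believedBy a χ → χ ≡ B a τ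
  ∈-believedBy⁻ {a = a} {χ = B b _} m with b Fin.≟ a | m
  ... | yes refl | here refl = refl
  ∈-believedBy⁻ {χ = var _} ()
  ∈-believedBy⁻ {χ = ¬' _} ()
  ∈-believedBy⁻ {χ = _ ∧' _} ()
  ∈-believedBy⁻ {χ = I _ _} ()
  ∈-believedBy⁻ {χ = K _ _} ()

  intentionTargets : Ag n → Fm n → List (Fm n)
  intentionTargets a (I b ψ) = if does (b Fin.≟ a) then I b ψ ∷ K b ψ ∷ ψ ∷ [] else []
  intentionTargets a _ = []

  ∈-intentionTargets⁺ : IStep a χ τ → τ ∈ intentionTargets a χ
  ∈-intentionTargets⁺ {a = a} introspect rewrite dec-true (a Fin.≟ a) refl = here refl
  ∈-intentionTargets⁺ {a = a} know rewrite dec-true (a Fin.≟ a) refl = there (here refl)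
  ∈-intentionTargets⁺ {a = a} intend rewrite dec-true (a Fin.≟ a) refl = there (there (here refl))

  ∈-intentionTargets⁻ : τ ∈ intentionTargets a χ → IStep a χ τ
  ∈-intentionTargets⁻ {a = a} {χ = I b _} m with b Fin.≟ a | m
  ... | yes refl | here refl = introspect
  ... | yes refl | there (here refl) = know
  ... | yes refl | there (there (here refl)) = intend
  ∈-intentionTargets⁻ {χ = var _} ()
  ∈-intentionTargets⁻ {χ = ¬' _} ()
  ∈-intentionTargets⁻ {χ = _ ∧' _} ()
  ∈-intentionTargets⁻ {χ = K _ _} ()
  ∈-intentionTargets⁻ {χ = B _ _} ()

  knowledge : Ag n → Modality
  knowledge a = record
    { □ = K a
    ; isNormal = record { distrib = K-K a ; necessitation = nec-K a }
    ; _↝_ = KStep a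
    ; targets = knowledgeTargets a
    ; ∈-targets⁺ = ∈-knowledgeTargets⁺
    ; ∈-targets⁻ = ∈-knowledgeTargets⁻
    ; ↝-□ = λ { (introspect i) → introspection i }
    ; ↝-closed = λ { _ χ∈ (introspect _) → χ∈ }
    }

  belief : Ag n → Modality
  belief a = record
    { □ = B a
    ; isNormal = record { distrib = K-B a ; necessitation = nec-B a }
    ; _↝_ = BStep a
    ; targets = λ χ → knowledgeTargets a χ ++ believedBy a χ
    ; ∈-targets⁺ = targets⁺
    ; ∈-targets⁻ = targets⁻
    ; ↝-□ = λ { (known s) → ⊢-trans (Modality.↝-□ (knowledge a) s) (KB a _) ; believe → ⊢-id }
    ; ↝-closed = λ { closed χ∈ (known s) → Modality.↝-closed (knowledge a) closed χ∈ s
                   ; closed χ∈ believe → Closed.B-closed closed χ∈ }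
    }
    where
    targets⁺ : BStep a χ τ → τ ∈ knowledgeTargets a χ ++ believedBy a χ
    targets⁺ (known s) = ∈-++⁺ˡ (∈-knowledgeTargets⁺ s)
    targets⁺ (believe {ψ = ψ}) = ∈-++⁺ʳ (knowledgeTargets a (B a ψ)) (∈-believedBy⁺ {a = a})

    targets⁻ : τ ∈ knowledgeTargets a χ ++ believedBy a χ → BStep a χ τ
    targets⁻ {χ = χ} m with ∈-++⁻ (knowledgeTargets a χ) m
    ... | inj₁ m′ = known (∈-knowledgeTargets⁻ m′)
    ... | inj₂ m′ with refl ← ∈-believedBy⁻ {a = a} {χ = χ} m′ = believe

  intention : Ag n → Modality
  intention a = record
    { □ = I a
    ; isNormal = record { distrib = K-I a ; necessitation = nec-I a }
    ; _↝_ = IStep a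
    ; targets = intentionTargets a
    ; ∈-targets⁺ = ∈-intentionTargets⁺
    ; ∈-targets⁻ = ∈-intentionTargets⁻
    ; ↝-□ = λ { introspect → 4-I a _ ; know → IIK a _ ; intend → ⊢-id }
    ; ↝-closed = λ { _ χ∈ introspect → χ∈
                   ; closed χ∈ know → Closed.I⇒K-closed closed χ∈
                   ; closed χ∈ intend → Closed.I-closed closed χ∈ }
    }

  literal : Fm n → Bool → Fm n
  literal χ true = χ
  literal χ false = ¬' χ

  ⊨literal⁺ : ⟦ χ ⟧ v ≡ b → v ⊨ literal χ b
  ⊨literal⁺ {b = true} eq = ⊨⁺ (from T-≡ eq)
  ⊨literal⁺ {b = false} eq = ⊨⁺ (from T-not-≡ eq)

  ⊨literal⁻ : v ⊨ literal χ b → ⟦ χ ⟧ v ≡ b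
  ⊨literal⁻ {b = true} (⊨⁺ t) = to T-≡ t
  ⊨literal⁻ {b = false} (⊨⁺ t) = to T-not-≡ t

  Agree : List (Fm n) → Valuation → Valuation → Set
  Agree Γ w d = ∀ {χ} → χ ∈ Γ → ⟦ χ ⟧ w ≡ d χ

  char : List (Fm n) → Valuation → Fm n
  char Γ d = ⋀ (map (λ χ → literal χ (d χ)) Γ)

  ⊨char⁺ : Agree Γ w d → w ⊨ char Γ d
  ⊨char⁺ agree = ⊨⋀⁺ (All.map⁺ (All.tabulate (⊨literal⁺ ∘ agree)))

  ⊨char⁻ : w ⊨ char Γ d → Agree Γ w d
  ⊨char⁻ h χ∈ = ⊨literal⁻ (All.lookup (All.map⁻ (⊨⋀⁻ h)) χ∈)

  char-true : χ ∈ Γ → T (d χ) → ⊢ (char Γ d →' χ)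
  char-true χ∈ t = taut-consequence [] λ _ _ → ⊨→⁺ λ c → ⊨⁺ (subst T (sym (⊨char⁻ c χ∈)) t)

  char-false : χ ∈ Γ → ¬ T (d χ) → ⊢ (char Γ d →' ¬' χ)
  char-false χ∈ ¬t = taut-consequence [] λ _ _ → ⊨→⁺ λ c → ⊨¬⁺ λ χ → ¬t (subst T (⊨char⁻ c χ∈) (⊨⁻ χ))

  char-unsat : (∀ w → ¬ Agree Γ w d) → ⊢ (¬' char Γ d)
  char-unsat unsat = taut-consequence [] λ w _ → ⊨¬⁺ λ c → unsat w (⊨char⁻ c)

  infixl 9 _[_≔_]
  _[_≔_] : Valuation → Fm n → Bool → Valuation
  (v [ χ ≔ b ]) ψ = if does (ψ ≟ χ) then b else v ψ

  valuations : List (Fm n) → List Valuation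
  valuations [] = (λ _ → false) ∷ []
  valuations (χ ∷ Γ) = cartesianProductWith (λ b v → v [ χ ≔ b ]) (true ∷ false ∷ []) (valuations Γ)

  valuations-cover : ∀ Γ w → ∃[ d ] d ∈ valuations Γ × Agree Γ w d
  valuations-cover [] w = _ , here refl , λ ()
  valuations-cover (χ ∷ Γ) w with valuations-cover Γ w
  ... | d , d∈ , agree =
    d [ χ ≔ ⟦ χ ⟧ w ] , ∈-cartesianProductWith⁺ (λ b v → v [ χ ≔ b ]) (∈-bools (⟦ χ ⟧ w)) d∈ , agree′
    where
    ∈-bools : ∀ b → b ∈ true ∷ false ∷ []
    ∈-bools true = here refl
    ∈-bools false = there (here refl)

    agree′ : Agree (χ ∷ Γ) w (d [ χ ≔ ⟦ χ ⟧ w ])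
    agree′ {ψ} ψ∈ with ψ ≟ χ | ψ∈
    ... | yes refl | _ = refl
    ... | no ψ≢χ | here refl = ⊥-elim (ψ≢χ refl)
    ... | no _ | there ψ∈Γ = agree ψ∈Γ

  by-valuations : ∀ Γ → (∀ {d} → d ∈ valuations Γ → ⊢ (char Γ d →' φ)) → ⊢ φ
  by-valuations {φ = φ} Γ h =
    taut-consequence {Γ = map (λ d → char Γ d →' φ) (valuations Γ)} (All.map⁺ (All.tabulate h)) λ w cases →
      let d , d∈ , agree = valuations-cover Γ w in ⊨→⁻ (All.lookup (All.map⁻ cases) d∈) (⊨char⁺ agree)

  module Canonical (Cl : List (Fm n)) where

    demands : Modality → Valuation → List (Fm n)
    demands M d = concatMap (Modality.targets M) (filter (T? ∘ d) Cl)

    module _ (M : Modality) where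
      open Modality M

      ∈-demands⁺ : χ ∈ Cl → T (d χ) → χ ↝ τ → τ ∈ demands M d
      ∈-demands⁺ {d = d} χ∈ t s = ∈-concatMap⁺ targets (lose (∈-filter⁺ (T? ∘ d) χ∈ t) (∈-targets⁺ s))

      ∈-demands⁻ : τ ∈ demands M d → ∃[ χ ] χ ∈ Cl × T (d χ) × χ ↝ τ
      ∈-demands⁻ {d = d} τ∈ =
        let χ , χ∈ , τ∈targets = find (∈-concatMap⁻ targets {xs = filter (T? ∘ d) Cl} τ∈)
            χ∈Cl , t = ∈-filter⁻ (T? ∘ d) χ∈
        in χ , χ∈Cl , t , ∈-targets⁻ τ∈targets

      Access : Valuation → Valuation → Set
      Access d e = ∀ {χ τ} → χ ∈ Cl → T (d χ) → χ ↝ τ → T (e τ)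

      all⇒access : All (T ∘ e) (demands M d) → Access d e
      all⇒access all χ∈ t s = All.lookup all (∈-demands⁺ χ∈ t s)

      access⇒all : Access d e → All (T ∘ e) (demands M d)
      access⇒all access = All.tabulate λ τ∈ → let _ , χ∈ , t , s = ∈-demands⁻ τ∈ in access χ∈ t s

      access? : ∀ d e → Dec (Access d e)
      access? d e = map′ all⇒access access⇒all (All.all? (T? ∘ e) (demands M d))

    K-refl : Access (knowledge a) d d
    K-refl _ t (introspect _) = t

    K-trans : Access (knowledge a) d e → Access (knowledge a) e f → Access (knowledge a) d f
    K-trans de ef χ∈ t (introspect i) = ef χ∈ (de χ∈ t (introspect i)) (introspect i)

    B⊆K : Access (belief a) d e → Access (knowledge a) d e
    B⊆K de χ∈ t s = de χ∈ t (known s)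

    K⨾B⊆B : Access (knowledge a) d e → Access (belief a) e f → Access (belief a) d f
    K⨾B⊆B de ef χ∈ t (known s) = K-trans de (B⊆K ef) χ∈ t s
    K⨾B⊆B de ef χ∈ t believe = ef χ∈ (de χ∈ t (introspect believed)) believe

    K⨾I⊆I : Access (knowledge a) d e → Access (intention a) e f → Access (intention a) d f
    K⨾I⊆I de ef χ∈ t introspect = ef χ∈ (de χ∈ t (introspect intended)) introspect
    K⨾I⊆I de ef χ∈ t know = ef χ∈ (de χ∈ t (introspect intended)) know
    K⨾I⊆I de ef χ∈ t intend = ef χ∈ (de χ∈ t (introspect intended)) intend

    I-trans : Access (intention a) d e → Access (intention a) e f → Access (intention a) d f
    I-trans de ef χ∈ t introspect = ef χ∈ (de χ∈ t introspect) introspect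
    I-trans de ef χ∈ t know = ef χ∈ (de χ∈ t introspect) know
    I-trans de ef χ∈ t intend = ef χ∈ (de χ∈ t introspect) intend

    Factive : Ag n → Valuation → Set
    Factive a f = ∀ {ψ} → K a ψ ∈ Cl → T (f (K a ψ)) → T (f ψ)

    char-□-demands : ∀ M d → ⊢ (char Cl d →' Modality.□ M (⋀ (demands M d)))
    char-□-demands M d = □-⋀ (demands M d) λ τ∈ →
      let _ , χ∈ , t , s = ∈-demands⁻ M τ∈ in ⊢-trans (char-true χ∈ t) (↝-□ s)
      where
      open Modality M
      open Normal isNormal

    Covers : List Valuation → Set
    Covers S = ∀ {d} → d ∈ valuations Cl → d ∈ S ⊎ ⊢ (¬' char Cl d)

    by-survivors : Covers S → (∀ {d} → d ∈ S → ⊢ (char Cl d →' φ)) → ⊢ φ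
    by-survivors covers h = by-valuations Cl λ d∈ → [ h , ⊢-explode ] (covers d∈)

    module _ (S : List Valuation) where

      Witness : Modality → Valuation → Fm n → Set
      Witness M d ψ = Any (λ e → Access M d e × ¬ T (e ψ)) S

      witness? : ∀ M d ψ → Dec (Witness M d ψ)
      witness? M d ψ = any? (λ e → access? M d e ×-dec ¬? (T? (e ψ))) S

      Coherent : Valuation → Fm n → Set
      Coherent d (var _) = ⊤
      Coherent d (¬' ψ) = d (¬' ψ) ≡ not (d ψ)
      Coherent d (ψ ∧' χ) = d (ψ ∧' χ) ≡ d ψ ∧ d χ
      Coherent d (K a ψ) = (T (d (K a ψ)) → T (d ψ)) × (¬ T (d (K a ψ)) → Witness (knowledge a) d ψ)
      Coherent d (B a ψ) = ¬ T (d (B a ψ)) → Witness (belief a) d ψ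
      Coherent d (I a ψ) = ¬ T (d (I a ψ)) → Witness (intention a) d ψ

      coherent? : ∀ d χ → Dec (Coherent d χ)
      coherent? d (var _) = yes tt
      coherent? d (¬' ψ) = d (¬' ψ) Bool.≟ not (d ψ)
      coherent? d (ψ ∧' χ) = d (ψ ∧' χ) Bool.≟ d ψ ∧ d χ
      coherent? d (K a ψ) = (T? _ →-dec T? _) ×-dec (¬? (T? _) →-dec witness? (knowledge a) d ψ)
      coherent? d (B a ψ) = ¬? (T? _) →-dec witness? (belief a) d ψ
      coherent? d (I a ψ) = ¬? (T? _) →-dec witness? (intention a) d ψ

      Serial : Valuation → Ag n → Set
      Serial d a = Any (Access (belief a) d) S × Any (Access (intention a) d) S

      serial? : ∀ d a → Dec (Serial d a)
      serial? d a = any? (access? (belief a) d) S ×-dec any? (access? (intention a) d) S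

      record Hintikka (d : Valuation) : Set where
        constructor hintikka
        field
          coherent : All (Coherent d) Cl
          serial : ∀ a → Serial d a

      hintikka? : ∀ d → Dec (Hintikka d)
      hintikka? d =
        map′ (uncurry hintikka) (λ h → Hintikka.coherent h , Hintikka.serial h)
             (All.all? (coherent? d) Cl ×-dec Fin.all? (serial? d))

    module _ (closed : Closed Cl) where
      open Closed closed

      I⨾K⊆I : Factive a f → Access (intention a) d e → Access (knowledge a) e f → Access (intention a) d f
      I⨾K⊆I _ de ef χ∈ t introspect = ef χ∈ (de χ∈ t introspect) (introspect intended)
      I⨾K⊆I _ de ef χ∈ t know = ef (I⇒K-closed χ∈) (de χ∈ t know) (introspect known)
      I⨾K⊆I factive de ef χ∈ t intend =
        factive (I⇒K-closed χ∈) (ef (I⇒K-closed χ∈) (de χ∈ t know) (introspect known))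

      demands-closed : ∀ M → τ ∈ demands M d → τ ∈ Cl
      demands-closed M τ∈ = let _ , χ∈ , _ , s = ∈-demands⁻ M τ∈ in Modality.↝-closed M closed χ∈ s

      module Elimination (covers : Covers S) where

        demands-entail : ∀ M → (∀ {e} → e ∈ S → Access M d e → ⊢ (char Cl e →' ψ)) →
                         ⊢ (⋀ (demands M d) →' ψ)
        demands-entail {d = d} {ψ = ψ} M h = by-survivors covers entail
          where
          entail : e ∈ S → ⊢ (char Cl e →' (⋀ (demands M d) →' ψ))
          entail {e} e∈ with All.all? (T? ∘ e) (demands M d)
          ... | yes all =
            ⊢-trans (h e∈ (all⇒access M all)) (taut-consequence [] λ _ _ → ⊨→⁺ λ ψ → ⊨→⁺ λ _ → ψ)
          ... | no ¬all with find (All.¬All⇒Any¬ (T? ∘ e) _ ¬all)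
          ...   | τ , τ∈ , ¬t = ⊢-trans (char-false (demands-closed M τ∈) ¬t) (taut-consequence [] λ _ _ →
                                  ⊨→⁺ λ ¬τ → ⊨→⁺ λ ⋀ → ⊥-elim (⊨¬⁻ ¬τ (All.lookup (⊨⋀⁻ ⋀) τ∈)))

        □-by-survivors : ∀ M → (∀ {e} → e ∈ S → Access M d e → ⊢ (char Cl e →' ψ)) →
                         ⊢ (char Cl d →' Modality.□ M ψ)
        □-by-survivors {d = d} M h =
          ⊢-trans (char-□-demands M d) (Normal.□-mono (Modality.isNormal M) (demands-entail M h))

        unwitnessed-refuted : ∀ M → Modality.□ M ψ ∈ Cl → ψ ∈ Cl → ¬ T (d (Modality.□ M ψ)) →
                              ¬ Witness S M d ψ → ⊢ (¬' char Cl d)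
        unwitnessed-refuted M □ψ∈ ψ∈ ¬t ¬witness = ⊢¬-intro
          (□-by-survivors M λ e∈ access →
            char-true ψ∈ (decidable-stable (T? _) λ ¬tψ → ¬witness (lose e∈ (access , ¬tψ))))
          (char-false □ψ∈ ¬t)

        -- Without successors, □ p and □ ¬ p both follow from char Cl d, against the D axiom.
        unserial-refuted : ∀ M → (∀ φ → ⊢ (Modality.□ M φ →' ¬' Modality.□ M (¬' φ))) →
                           ¬ Any (Access M d) S → ⊢ (¬' char Cl d)
        unserial-refuted {d = d} M D ¬serial =
          ⊢¬-intro (vacuous (¬' var 0)) (⊢-trans (vacuous (var 0)) (D (var 0)))
          where
          vacuous : ∀ ψ → ⊢ (char Cl d →' Modality.□ M ψ)
          vacuous ψ = □-by-survivors M λ e∈ access → ⊥-elim (¬serial (lose e∈ access))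

        incoherent-refuted : χ ∈ Cl → ¬ Coherent S d χ → ⊢ (¬' char Cl d)
        incoherent-refuted {χ = var _} _ ¬coherent = ⊥-elim (¬coherent tt)
        incoherent-refuted {χ = ¬' ψ} χ∈ ¬coherent =
          char-unsat λ _ agree → ¬coherent (trans (sym (agree χ∈)) (cong not (agree (¬-closed χ∈))))
        incoherent-refuted {χ = ψ ∧' χ} χ∈ ¬coherent =
          char-unsat λ _ agree →
            ¬coherent (trans (sym (agree χ∈)) (cong₂ _∧_ (agree (∧-closedˡ χ∈)) (agree (∧-closedʳ χ∈))))
        incoherent-refuted {χ = K a ψ} {d = d} χ∈ ¬coherent with T? (d (K a ψ))
        ... | yes t = ⊢¬-intro (⊢-trans (char-true χ∈ t) (T-K a ψ))
                               (char-false (K-closed χ∈) λ tψ → ¬coherent ((λ _ → tψ) , λ ¬t → ⊥-elim (¬t t)))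
        ... | no ¬t = unwitnessed-refuted (knowledge a) χ∈ (K-closed χ∈) ¬t λ w →
                        ¬coherent ((λ t → ⊥-elim (¬t t)) , λ _ → w)
        incoherent-refuted {χ = B a ψ} χ∈ ¬coherent =
          unwitnessed-refuted (belief a) χ∈ (B-closed χ∈)
            (λ t → ¬coherent λ ¬t → ⊥-elim (¬t t)) (λ w → ¬coherent λ _ → w)
        incoherent-refuted {χ = I a ψ} χ∈ ¬coherent =
          unwitnessed-refuted (intention a) χ∈ (I-closed χ∈)
            (λ t → ¬coherent λ ¬t → ⊥-elim (¬t t)) (λ w → ¬coherent λ _ → w)

        non-hintikka-refuted : ¬ Hintikka S d → ⊢ (¬' char Cl d)
        non-hintikka-refuted {d = d} ¬hintikka with All.all? (coherent? S d) Cl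
        ... | no ¬coherent =
          let _ , χ∈ , ¬c = find (All.¬All⇒Any¬ (coherent? S d) Cl ¬coherent) in incoherent-refuted χ∈ ¬c
        ... | yes coherent with Fin.¬∀⟶∃¬ _ (Serial S d) (serial? S d) (¬hintikka ∘ hintikka coherent)
        ...   | a , ¬serial with any? (access? (belief a) d) S
        ...     | yes serialB = unserial-refuted (intention a) (D-I a) (¬serial ∘ (serialB ,_))
        ...     | no ¬serialB = unserial-refuted (belief a) (D-B a) ¬serialB

      eliminate : ∀ k S → length S < k → Covers S → ∃[ S′ ] Covers S′ × All (Hintikka S′) S′
      eliminate (suc k) S (s≤s len) covers with All.all? (hintikka? S) S
      ... | yes all = S , covers , all
      ... | no ¬all = eliminate k (filter (hintikka? S) S) shrinks covers′
        where
        shrinks : length (filter (hintikka? S) S) < k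
        shrinks = ℕ.≤-trans (filter-notAll (hintikka? S) S (All.¬All⇒Any¬ (hintikka? S) S ¬all)) len

        covers′ : Covers (filter (hintikka? S) S)
        covers′ {d} d∈ with covers d∈
        ... | inj₂ refuted = inj₂ refuted
        ... | inj₁ d∈S with hintikka? S d
        ...   | yes h = inj₁ (∈-filter⁺ (hintikka? S) d∈S h)
        ...   | no ¬h = inj₂ (Elimination.non-hintikka-refuted covers ¬h)

      module Model (S : List Valuation) (all-hintikka : All (Hintikka S) S) where

        box? : (M : Modality) (P : Valuation → Bool) (d : Valuation) →
               Dec (All (λ e → Access M d e → T (P e)) S)
        box? M P d = All.all? (λ e → access? M d e →-dec T? (P e)) S

        box : Modality → (Valuation → Bool) → Valuation → Bool
        box M P d = ⌊ box? M P d ⌋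

        box⁺ : ∀ M {P d} → (∀ {e} → e ∈ S → Access M d e → T (P e)) → T (box M P d)
        box⁺ M {P} {d} h = fromWitness {a? = box? M P d} (All.tabulate h)

        box⁻ : ∀ M {P d e} → T (box M P d) → e ∈ S → Access M d e → T (P e)
        box⁻ M {P} {d} h = All.lookup (toWitness {a? = box? M P d} h)

        sat : Valuation → Fm n → Bool
        sat d (var p) = d (var p)
        sat d (¬' ψ) = not (sat d ψ)
        sat d (ψ ∧' χ) = sat d ψ ∧ sat d χ
        sat d (K a ψ) = box (knowledge a) (λ e → sat e ψ) d
        sat d (B a ψ) = box (belief a) (λ e → sat e ψ) d
        sat d (I a ψ) = box (intention a) (λ e → sat e ψ) d

        ⟦⟧-sat : ∀ ψ → ⟦ ψ ⟧ (sat d) ≡ sat d ψ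
        ⟦⟧-sat (var _) = refl
        ⟦⟧-sat (¬' ψ) = cong not (⟦⟧-sat ψ)
        ⟦⟧-sat (ψ ∧' χ) = cong₂ _∧_ (⟦⟧-sat ψ) (⟦⟧-sat χ)
        ⟦⟧-sat (I _ _) = refl
        ⟦⟧-sat (K _ _) = refl
        ⟦⟧-sat (B _ _) = refl

        coherent-at : d ∈ S → χ ∈ Cl → Coherent S d χ
        coherent-at d∈ = All.lookup (Hintikka.coherent (All.lookup all-hintikka d∈))

        serial-at : d ∈ S → ∀ a → Serial S d a
        serial-at d∈ = Hintikka.serial (All.lookup all-hintikka d∈)

        factive-at : d ∈ S → Factive a d
        factive-at d∈ Kψ∈ = proj₁ (coherent-at d∈ Kψ∈)

        box-distrib : ∀ M φ ψ → T (box M (λ e → sat e (φ →' ψ)) d) → T (box M (λ e → sat e φ) d) →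
                      T (box M (λ e → sat e ψ) d)
        box-distrib M φ ψ h₁ h₂ = box⁺ M λ e∈ access → T-⇒⁻ {sat _ φ} (box⁻ M h₁ e∈ access) (box⁻ M h₂ e∈ access)

        box-mono : ∀ M₁ M₂ {P} → (∀ {e} → Access M₂ d e → Access M₁ d e) → T (box M₁ P d) → T (box M₂ P d)
        box-mono M₁ M₂ incl h = box⁺ M₂ λ e∈ access → box⁻ M₁ h e∈ (incl access)

        box-compose : ∀ M₁ M₂ M₃ {P} → (∀ {e f} → f ∈ S → Access M₂ d e → Access M₃ e f → Access M₁ d f) →
                      T (box M₁ P d) → T (box M₂ (box M₃ P) d)
        box-compose M₁ M₂ M₃ comp h = box⁺ M₂ λ _ de → box⁺ M₃ λ f∈ ef → box⁻ M₁ h f∈ (comp f∈ de ef)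

        box-serial : ∀ M {P} → Any (Access M d) S → T (box M P d) → T (not (box M (not ∘ P) d))
        box-serial M serial h = T-not⁺ λ h¬ →
          let _ , e∈ , access = find serial in T-not⁻ (box⁻ M h¬ e∈ access) (box⁻ M h e∈ access)

        -- The formulas are explicit: Agda cannot recover them from the unfolded Boolean goal.
        sat-→⁺ : ∀ φ ψ → (T (sat d φ) → T (sat d ψ)) → T (sat d (φ →' ψ))
        sat-→⁺ {d = d} φ ψ = T-⇒⁺ {sat d φ} {sat d ψ}

        sound : ⊢ ψ → d ∈ S → T (sat d ψ)
        sound {ψ} {d} (taut t) _ = subst T (⟦⟧-sat ψ) (from T-≡ (t (sat d)))
        sound (K-I a φ ψ) _ = sat-→⁺ (I a (φ →' ψ)) (I a φ →' I a ψ) λ h →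
          sat-→⁺ (I a φ) (I a ψ) (box-distrib (intention a) φ ψ h)
        sound (K-K a φ ψ) _ = sat-→⁺ (K a (φ →' ψ)) (K a φ →' K a ψ) λ h →
          sat-→⁺ (K a φ) (K a ψ) (box-distrib (knowledge a) φ ψ h)
        sound (K-B a φ ψ) _ = sat-→⁺ (B a (φ →' ψ)) (B a φ →' B a ψ) λ h →
          sat-→⁺ (B a φ) (B a ψ) (box-distrib (belief a) φ ψ h)
        sound (T-K a φ) d∈ = sat-→⁺ (K a φ) φ λ h → box⁻ (knowledge a) h d∈ K-refl
        sound (4-K a φ) _ =
          sat-→⁺ (K a φ) (K a (K a φ)) (box-compose (knowledge a) (knowledge a) (knowledge a) λ _ → K-trans)
        sound (D-B a φ) d∈ = sat-→⁺ (B a φ) (¬' B a (¬' φ)) (box-serial (belief a) (proj₁ (serial-at d∈ a)))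
        sound (KB a φ) _ = sat-→⁺ (K a φ) (B a φ) (box-mono (knowledge a) (belief a) B⊆K)
        sound (BKB a φ) _ =
          sat-→⁺ (B a φ) (K a (B a φ)) (box-compose (belief a) (knowledge a) (belief a) λ _ → K⨾B⊆B)
        sound (D-I a φ) d∈ = sat-→⁺ (I a φ) (¬' I a (¬' φ)) (box-serial (intention a) (proj₂ (serial-at d∈ a)))
        sound (IKI a φ) _ =
          sat-→⁺ (I a φ) (K a (I a φ)) (box-compose (intention a) (knowledge a) (intention a) λ _ → K⨾I⊆I)
        sound (IIK a φ) _ =
          sat-→⁺ (I a φ) (I a (K a φ))
            (box-compose (intention a) (intention a) (knowledge a) λ f∈ → I⨾K⊆I (factive-at f∈))
        sound (4-I a φ) _ =
          sat-→⁺ (I a φ) (I a (I a φ)) (box-compose (intention a) (intention a) (intention a) λ _ → I-trans)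
        sound (mp {φ} p q) d∈ = T-⇒⁻ {sat _ φ} (sound p d∈) (sound q d∈)
        sound (nec-I a p) _ = box⁺ (intention a) λ e∈ _ → sound p e∈
        sound (nec-K a p) _ = box⁺ (knowledge a) λ e∈ _ → sound p e∈
        sound (nec-B a p) _ = box⁺ (belief a) λ e∈ _ → sound p e∈

        box-truth : ∀ M → (∀ {e} → e ∈ S → sat e ψ ≡ e ψ) →
                    (T b → ∀ {e} → e ∈ S → Access M d e → T (e ψ)) → (¬ T b → Witness S M d ψ) →
                    box M (λ e → sat e ψ) d ≡ b
        box-truth M ih forced witness = T-injective
          (λ h → decidable-stable (T? _) λ ¬t →
            let _ , e∈ , access , ¬tψ = find (witness ¬t) in ¬tψ (subst T (ih e∈) (box⁻ M h e∈ access)))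
          (λ t → box⁺ M λ e∈ access → subst T (sym (ih e∈)) (forced t e∈ access))

        truth : ψ ∈ Cl → d ∈ S → sat d ψ ≡ d ψ
        truth {var _} _ _ = refl
        truth {¬' ψ} ψ∈ d∈ = trans (cong not (truth (¬-closed ψ∈) d∈)) (sym (coherent-at d∈ ψ∈))
        truth {ψ ∧' χ} ψ∈ d∈ =
          trans (cong₂ _∧_ (truth (∧-closedˡ ψ∈) d∈) (truth (∧-closedʳ ψ∈) d∈)) (sym (coherent-at d∈ ψ∈))
        truth {K a ψ} Kψ∈ d∈ = box-truth (knowledge a) (truth (K-closed Kψ∈))
          (λ t e∈ access → factive-at e∈ Kψ∈ (access Kψ∈ t (introspect known))) (proj₂ (coherent-at d∈ Kψ∈))
        truth {B a ψ} Bψ∈ d∈ =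
          box-truth (belief a) (truth (B-closed Bψ∈)) (λ t _ access → access Bψ∈ t believe) (coherent-at d∈ Bψ∈)
        truth {I a ψ} Iψ∈ d∈ =
          box-truth (intention a) (truth (I-closed Iψ∈)) (λ t _ access → access Iψ∈ t intend) (coherent-at d∈ Iψ∈)

      decide : φ ∈ Cl → Dec (⊢ φ)
      decide {φ} φ∈ with eliminate (suc (length (valuations Cl))) (valuations Cl) ℕ.≤-refl inj₁
      ... | S , covers , all-hintikka with any? (λ d → ¬? (T? (d φ))) S
      ...   | yes countermodel = no λ ⊢φ →
              let d , d∈ , ¬t = find countermodel in ¬t (subst T (truth φ∈ d∈) (sound ⊢φ d∈))
        where open Model S all-hintikka
      ...   | no ¬countermodel = yes (by-survivors covers λ d∈ →
              char-true φ∈ (decidable-stable (T? _) λ ¬t → ¬countermodel (lose d∈ ¬t)))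

theorem2 : (n : ℕ) → (φ : Fm n) → Dec (⊢ φ)
theorem2 n φ = Canonical.decide (closure φ) (closure-closed φ) (∈-closure φ)
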